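{- Let $T$ be a pre-Galois word, $p_o=\mathrm{Per}_o(T)$ and $p_e=\mathrm{Per}_e(T)$. For a symbol $z$, the word $T'=T\cdot z$ is pre-Galois if and only if both $T'[1..|T|-p_o+1]\preceq_{\mathrm{alt}}T'[p_o+1..|T|+1]$ and $T'[1..|T|-p_e+1]\preceq_{\mathrm{alt}}T'[p_e+1..|T|+1]$ hold.
   Context: $W[i..j]$ is the factor from position $i$ to $j$ (1-indexed), and is the empty word $\varepsilon$ if $i>j$. An integer $p\in[1..|W|]$ is a period of $W$ if $W[i+p]=W[i]$ for all $i\in[1..|W|-p]$. $\mathrm{Per}_o(W)$ (resp. $\mathrm{Per}_e(W)$) is the shortest odd (resp. even) period of $W$, and is set to $|W|+1$ if $W$ has no odd (resp. even) period. Alternating order: for words $S,T$ with $S^\omega\neq T^\omega$ ($X^\omega$ the infinite repetition of $X$), let $j$ be the first position with $S^\omega[j]\neq T^\omega[j]$; $S\prec_{\mathrm{alt}}T$ if $j$ is odd and $S^\omega[j]<T^\omega[j]$, or $j$ is even and $S^\omega[j]>T^\omega[j]$. $S=_{\mathrm{alt}}T$ if $S^\omega=T^\omega$; $\varepsilon\succ_{\mathrm{alt}}X$ for every nonempty $X$; $S\preceq_{\mathrm{alt}}T$ means $S\prec_{\mathrm{alt}}T$ or $S=_{\mathrm{alt}}T$. A word $T$ is pre-Galois if every proper suffix $S$ of $T$ is a prefix of $T$ or satisfies $S\succ_{\mathrm{alt}}T$. -}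

module Defs where

open import Data.Nat using (ℕ; zero; suc; _+_; _*_; _∸_; _≤_; _<_; _>_)
open import Data.Nat.DivMod using (_mod_)
open import Data.List using (List; []; _∷_; _++_; length; take; drop; head; lookup)
open import Data.Maybe using (Maybe)
open import Data.Product using (Σ; ∃; ∃-syntax; _×_; _,_)
open import Data.Sum using (_⊎_)
open import Data.Unit using (⊤)
open import Data.Empty using (⊥)
open import Relation.Nullary using (¬_)
open import Relation.Binary.PropositionalEquality using (_≡_)

Word : Set
Word = List ℕ

-- W[i..j], 1-indexed; empty if i > j.
factor : Word → ℕ → ℕ → Word
factor W i j = take (suc j ∸ i) (drop (i ∸ 1) W)

-- 0-indexed letter access (nothing if out of range)
at : Word → ℕ → Maybe ℕ
at W i = head (drop i W)

Odd : ℕ → Set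
Odd p = ∃[ k ] p ≡ suc (2 * k)

Even : ℕ → Set
Even p = ∃[ k ] p ≡ 2 * k

IsPeriod : Word → ℕ → Set
IsPeriod W p = (1 ≤ p) × (p ≤ length W) ×
  (∀ i → i + p < length W → at W (i + p) ≡ at W i)

IsPerO : Word → ℕ → Set
IsPerO W p =
  (IsPeriod W p × Odd p × (∀ q → IsPeriod W q → Odd q → p ≤ q))
  ⊎ ((∀ q → IsPeriod W q → ¬ Odd q) × p ≡ suc (length W))

IsPerE : Word → ℕ → Set
IsPerE W p =
  (IsPeriod W p × Even p × (∀ q → IsPeriod W q → Even q → p ≤ q))
  ⊎ ((∀ q → IsPeriod W q → ¬ Even q) × p ≡ suc (length W))

-- X^ω for nonempty X = x ∷ xs, as a function of the 0-indexed position
omega : ℕ → List ℕ → ℕ → ℕ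
omega x xs i = lookup (x ∷ xs) (i mod (length (x ∷ xs)))

_=alt_ : Word → Word → Set
[] =alt [] = ⊤
[] =alt (_ ∷ _) = ⊥
(_ ∷ _) =alt [] = ⊥
(x ∷ xs) =alt (y ∷ ys) = ∀ i → omega x xs i ≡ omega y ys i

-- S ≺alt T. With 0-indexed first difference j, the 1-indexed position j+1 is odd iff j is even.
-- ε ≻alt X for nonempty X.
_≺alt_ : Word → Word → Set
[] ≺alt _ = ⊥
(_ ∷ _) ≺alt [] = ⊤
(x ∷ xs) ≺alt (y ∷ ys) = ∃[ j ]
  ((∀ i → i < j → omega x xs i ≡ omega y ys i) ×
   ((Even j × omega x xs j < omega y ys j) ⊎ (Odd j × omega x xs j > omega y ys j)))

_⪯alt_ : Word → Word → Set
S ⪯alt T = (S ≺alt T) ⊎ (S =alt T)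

IsPrefix : Word → Word → Set
IsPrefix S T = ∃[ U ] S ++ U ≡ T

PreGalois : Word → Set
PreGalois T = ∀ k → 1 ≤ k → k ≤ length T →
  IsPrefix (drop k T) T ⊎ (T ≺alt drop k T)

{-# OPTIONS --safe #-}
module Submission where

-- A proper suffix drop k T · z of T·z whose part drop k T is not a prefix of T already differs
-- from T inside T, where T being pre-Galois decides the comparison.  Otherwise k is a period of
-- T, and the comparison of T·z with drop k T · z is that of a = T[|T| - k] (0-indexed) with z
-- at position |T| - k.  Let p ≤ k be the shortest period of T of the parity of k.  The
-- pre-Galois property of T at its suffix drop (k - p) T compares a with b = T[|T| - p] at
-- position |T| - k, the condition for p compares b with z at position |T| - p, and as k - p is
-- even the two comparisons are oriented alike and chain to a comparison of a with z.
-- Conversely, the condition for p follows from the pre-Galois property of T·z at its suffix drop p.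

open import Defs
open import Data.Nat using (ℕ; zero; suc; _+_; _∸_; _≤_; _<_; _>_; z≤n; s≤s; _≟_)
open import Data.Nat.Properties
open import Data.Nat.DivMod using (_mod_; m<n⇒m%n≡m)
open import Data.Fin using (Fin; toℕ)
open import Data.Fin.Properties using (toℕ-fromℕ<)
open import Data.List using ([]; _∷_; _++_; _∷ʳ_; [_]; length; take; drop; lookup)
open import Data.List.Properties using (length-++; length-drop; take-all; drop-all)
open import Data.Maybe using (just)
open import Data.Maybe.Properties using (just-injective)
open import Data.Product using (∃-syntax; _×_; _,_)
open import Data.Sum using (_⊎_; inj₁; inj₂; map₂)
open import Data.Unit using (tt)
open import Function using (_∘_)
open import Function.Bundles using (_⇔_; mk⇔)
open import Relation.Nullary using (¬_; yes; no; contradiction)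
open import Relation.Binary.Definitions using (tri<; tri≈; tri>)
open import Relation.Binary.PropositionalEquality
  using (_≡_; _≢_; refl; sym; trans; cong; subst; subst₂; module ≡-Reasoning)

private
  variable
    a b c i j k n p : ℕ
    x y : ℕ
    xs ys T W X Y : Word
    P : ℕ → Set

even-or-odd : ∀ n → Even n ⊎ Odd n
even-or-odd zero = inj₁ (0 , refl)
even-or-odd (suc n) with even-or-odd n
... | inj₁ (m , refl) = inj₂ (m , refl)
... | inj₂ (m , refl) = inj₁ (suc m , sym (*-suc 2 m))

even⇒¬odd : Even n → ¬ Odd n
even⇒¬odd (m , refl) (l , eq) = even≢odd m l eq

even-+ : Even i → Even j → Even (i + j)
even-+ (m , refl) (l , refl) = m + l , sym (*-distribˡ-+ 2 m l)

odd-+ : Odd i → Even j → Odd (i + j)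
odd-+ (m , refl) (l , refl) = m + l , cong suc (sym (*-distribˡ-+ 2 m l))

even-∸ : Even i → Even j → Even (i ∸ j)
even-∸ (m , refl) (l , refl) = m ∸ l , sym (*-distribˡ-∸ 2 m l)

odd-∸ : Odd i → Odd j → Even (i ∸ j)
odd-∸ (m , refl) (l , refl) = m ∸ l , sym (*-distribˡ-∸ 2 m l)

AltLess : ℕ → ℕ → ℕ → Set
AltLess j a b = (Even j × a < b) ⊎ (Odd j × a > b)

altLess⇒≢ : AltLess j a b → a ≢ b
altLess⇒≢ (inj₁ (_ , a<b)) refl = <-irrefl refl a<b
altLess⇒≢ (inj₂ (_ , a>b)) refl = <-irrefl refl a>b

altLess-trans : AltLess j a b → AltLess j b c → AltLess j a c
altLess-trans (inj₁ (e , a<b)) (inj₁ (_ , b<c)) = inj₁ (e , <-trans a<b b<c)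
altLess-trans (inj₂ (o , a>b)) (inj₂ (_ , b>c)) = inj₂ (o , <-trans b>c a>b)
altLess-trans (inj₁ (e , _)) (inj₂ (o , _)) = contradiction o (even⇒¬odd e)
altLess-trans (inj₂ (o , _)) (inj₁ (e , _)) = contradiction o (even⇒¬odd e)

altLess-trans-≡ : a ≡ b ⊎ AltLess j a b → b ≡ c ⊎ AltLess j b c → a ≢ c → AltLess j a c
altLess-trans-≡ (inj₁ refl) (inj₁ refl) a≢c = contradiction refl a≢c
altLess-trans-≡ (inj₁ refl) (inj₂ b<c) _ = b<c
altLess-trans-≡ (inj₂ a<b) (inj₁ refl) _ = a<b
altLess-trans-≡ (inj₂ a<b) (inj₂ b<c) _ = altLess-trans a<b b<c

altLess-+even : Even n → AltLess (j + n) a b → AltLess j a b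
altLess-+even {j = j} en r with even-or-odd j | r
... | inj₁ ej | inj₁ (_ , a<b) = inj₁ (ej , a<b)
... | inj₁ ej | inj₂ (o , _)   = contradiction o (even⇒¬odd (even-+ ej en))
... | inj₂ oj | inj₁ (e , _)   = contradiction (odd-+ oj en) (even⇒¬odd e)
... | inj₂ oj | inj₂ (_ , a>b) = inj₂ (oj , a>b)

at-just⇒< : ∀ X i → at X i ≡ just a → i < length X
at-just⇒< (_ ∷ _) zero    _  = s≤s z≤n
at-just⇒< (_ ∷ X) (suc i) eq = s≤s (at-just⇒< X i eq)

<⇒at-just : ∀ X i → i < length X → ∃[ a ] at X i ≡ just a
<⇒at-just (x ∷ _) zero    _         = x , refl
<⇒at-just (_ ∷ X) (suc i) (s≤s i<X) = <⇒at-just X i i<X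

at-drop : ∀ X k i → at (drop k X) i ≡ at X (k + i)
at-drop X       zero    i       = refl
at-drop []      (suc k) zero    = refl
at-drop []      (suc k) (suc i) = refl
at-drop (_ ∷ X) (suc k) i       = at-drop X k i

at-++ˡ : ∀ X Y → i < length X → at (X ++ Y) i ≡ at X i
at-++ˡ {zero}  (_ ∷ _) Y _         = refl
at-++ˡ {suc i} (_ ∷ X) Y (s≤s i<X) = at-++ˡ X Y i<X

at-∷ʳ : ∀ X y → at (X ∷ʳ y) (length X) ≡ just y
at-∷ʳ []      y = refl
at-∷ʳ (_ ∷ X) y = at-∷ʳ X y

at-take : ∀ X → i < n → at (take n X) i ≡ at X i
at-take {n = suc n} []     _         = refl
at-take {zero}  {suc n} (_ ∷ X) _         = refl
at-take {suc i} {suc n} (_ ∷ X) (s≤s i<n) = at-take X i<n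

at-prefix : IsPrefix X Y → i < length X → at X i ≡ at Y i
at-prefix {X} (U , refl) i<X = sym (at-++ˡ X U i<X)

at-lookup : ∀ X (f : Fin (length X)) → at X (toℕ f) ≡ just (lookup X f)
at-lookup (_ ∷ _) Fin.zero    = refl
at-lookup (_ ∷ X) (Fin.suc f) = at-lookup X f

at-omega : ∀ x xs → i < length (x ∷ xs) → at (x ∷ xs) i ≡ just (omega x xs i)
at-omega {i} x xs i<n = begin
  at (x ∷ xs) i                               ≡⟨ cong (at (x ∷ xs)) (sym toℕ-mod) ⟩
  at (x ∷ xs) (toℕ (i mod length (x ∷ xs)))  ≡⟨ at-lookup (x ∷ xs) (i mod length (x ∷ xs)) ⟩
  just (omega x xs i)                         ∎
  where
  open ≡-Reasoning
  toℕ-mod : toℕ (i mod length (x ∷ xs)) ≡ i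
  toℕ-mod = trans (toℕ-fromℕ< _) (m<n⇒m%n≡m i<n)

at-just⇒omega : ∀ x xs i → at (x ∷ xs) i ≡ just a → omega x xs i ≡ a
at-just⇒omega x xs i eq = just-injective (trans (sym (at-omega x xs (at-just⇒< (x ∷ xs) i eq))) eq)

isPrefix⇒take : IsPrefix X Y → take (length X) Y ≡ X
isPrefix⇒take {[]}    _              = refl
isPrefix⇒take {x ∷ X} (U , refl) = cong (x ∷_) (isPrefix⇒take (U , refl))

drop-∷ʳ : ∀ T (z : ℕ) → k ≤ length T → drop k (T ∷ʳ z) ≡ drop k T ∷ʳ z
drop-∷ʳ {zero}  T       z _         = refl
drop-∷ʳ {suc k} (_ ∷ T) z (s≤s k≤T) = drop-∷ʳ T z k≤T

length-drop-≤ : ∀ k (W : Word) → length (drop k W) ≤ length W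
length-drop-≤ k W = subst (_≤ length W) (sym (length-drop k W)) (m∸n≤m (length W) k)

length-∷ʳ : ∀ T (z : ℕ) → length (T ∷ʳ z) ≡ suc (length T)
length-∷ʳ T z = trans (length-++ T) (+-comm (length T) 1)

=alt-refl : ∀ X → X =alt X
=alt-refl []      = tt
=alt-refl (_ ∷ _) = λ _ → refl

record Fork (j : ℕ) (X Y : Word) (a b : ℕ) : Set where
  constructor fork
  field
    agree : ∀ {i} → i < j → at X i ≡ at Y i
    atˡ   : at X j ≡ just a
    atʳ   : at Y j ≡ just b
open Fork

fork-sym : Fork j X Y a b → Fork j Y X b a
fork-sym f = fork (sym ∘ agree f) (atʳ f) (atˡ f)

fork-∷ : Fork j X Y a b → Fork (suc j) (x ∷ X) (x ∷ Y) a b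
fork-∷ f = fork (λ { {zero} _ → refl ; {suc i} (s≤s i<j) → agree f i<j }) (atˡ f) (atʳ f)

fork-++ : ∀ U V → Fork j X Y a b → Fork j (X ++ U) (Y ++ V) a b
fork-++ {j} {X} {Y} U V f = fork agree′ (trans (at-++ˡ X U j<X) (atˡ f)) (trans (at-++ˡ Y V j<Y) (atʳ f))
  where
  j<X : j < length X
  j<X = at-just⇒< X j (atˡ f)
  j<Y : j < length Y
  j<Y = at-just⇒< Y j (atʳ f)
  agree′ : i < j → at (X ++ U) i ≡ at (Y ++ V) i
  agree′ i<j = trans (at-++ˡ X U (<-trans i<j j<X))
                 (trans (agree f i<j) (sym (at-++ˡ Y V (<-trans i<j j<Y))))

fork-take : j < n → Fork j X Y a b → Fork j (take n X) (take n Y) a b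
fork-take {j = j} {n = n} {X = X} {Y = Y} j<n f =
  fork agree′ (trans (at-take X j<n) (atˡ f)) (trans (at-take Y j<n) (atʳ f))
  where
  agree′ : i < j → at (take n X) i ≡ at (take n Y) i
  agree′ i<j = trans (at-take X (<-trans i<j j<n))
                 (trans (agree f i<j) (sym (at-take Y (<-trans i<j j<n))))

fork-omega : Fork j (x ∷ xs) (y ∷ ys) a b →
  (∀ {i} → i < j → omega x xs i ≡ omega y ys i) × omega x xs j ≡ a × omega y ys j ≡ b
fork-omega {j} {x} {xs} {y} {ys} f =
  agree′ , at-just⇒omega x xs j (atˡ f) , at-just⇒omega y ys j (atʳ f)
  where
  agree′ : i < j → omega x xs i ≡ omega y ys i
  agree′ {i} i<j = sym (at-just⇒omega y ys i (trans (sym (agree f i<j))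
                 (at-omega x xs (<-trans i<j (at-just⇒< (x ∷ xs) j (atˡ f))))))

altLess⇒≺alt : Fork j X Y a b → AltLess j a b → X ≺alt Y
altLess⇒≺alt {j} {[]}    f _ = contradiction (at-just⇒< [] j (atˡ f)) n≮0
altLess⇒≺alt {X = _ ∷ _} {[]}    _ _ = tt
altLess⇒≺alt {j} {_ ∷ _} {_ ∷ _} f r with fork-omega f
... | agree′ , refl , refl = j , (λ _ → agree′) , r

≺alt⇒altLess : Fork j X Y a b → a ≢ b → X ≺alt Y → AltLess j a b
≺alt⇒altLess {j} {_ ∷ _} {[]}    f _ _ = contradiction (at-just⇒< [] j (atʳ f)) n≮0
≺alt⇒altLess {j} {_ ∷ _} {_ ∷ _} f a≢b (j′ , agree′ , r) with fork-omega f | <-cmp j′ j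
... | agree″ , _ , _ | tri< j′<j _ _ = contradiction (agree″ j′<j) (altLess⇒≢ r)
... | _ , refl , refl | tri> _ _ j′>j = contradiction (agree′ j j′>j) a≢b
... | _ , refl , refl | tri≈ _ refl _ = r

=alt⇒≡ : Fork j X Y a b → X =alt Y → a ≡ b
=alt⇒≡ {j} {[]}    f _ = contradiction (at-just⇒< [] j (atˡ f)) n≮0
=alt⇒≡ {j} {_ ∷ _} {[]}    f ()
=alt⇒≡ {j} {_ ∷ _} {_ ∷ _} f eq with fork-omega f
... | _ , refl , refl = eq j

isPrefix⇒≡ : Fork j X Y a b → IsPrefix X Y → a ≡ b
isPrefix⇒≡ {j} {X} f pre =
  just-injective (trans (sym (atˡ f)) (trans (at-prefix pre (at-just⇒< X j (atˡ f))) (atʳ f)))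

prefix⊎fork : ∀ X Y → length X ≤ length Y →
  IsPrefix X Y ⊎ ∃[ j ] ∃[ a ] ∃[ b ] (a ≢ b × Fork j X Y a b)
prefix⊎fork []      Y       _ = inj₁ (Y , refl)
prefix⊎fork (x ∷ X) (y ∷ Y) (s≤s X≤Y) with x ≟ y
... | no x≢y = inj₂ (0 , x , y , x≢y , fork (λ ()) refl refl)
... | yes refl with prefix⊎fork X Y X≤Y
...   | inj₁ (U , refl) = inj₁ (U , refl)
...   | inj₂ (j , a , b , a≢b , f) = inj₂ (suc j , a , b , a≢b , fork-∷ f)

agree⇒isPrefix : length X ≤ length Y → (∀ {i} → i < length X → at X i ≡ at Y i) → IsPrefix X Y
agree⇒isPrefix {X} {Y} X≤Y agree′ with prefix⊎fork X Y X≤Y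
... | inj₁ pre = pre
... | inj₂ (j , a , b , a≢b , f) = contradiction
  (just-injective (trans (sym (atˡ f)) (trans (agree′ (at-just⇒< X j (atˡ f))) (atʳ f)))) a≢b

fork⇒isPrefix : Fork j X Y a a → length X ≡ suc j → length X ≤ length Y → IsPrefix X Y
fork⇒isPrefix {j} {X} {Y} f |X|≡1+j X≤Y = agree⇒isPrefix X≤Y agree′
  where
  agree′ : i < length X → at X i ≡ at Y i
  agree′ {i} i<X with m<1+n⇒m<n∨m≡n (subst (i <_) |X|≡1+j i<X)
  ... | inj₁ i<j  = agree f i<j
  ... | inj₂ refl = trans (atˡ f) (sym (atʳ f))

n∸k<n : 1 ≤ k → k ≤ n → n ∸ k < n
n∸k<n {n = n} 1≤k k≤n = ∸-monoʳ-< {n} {_} {0} 1≤k k≤n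

m<o∸n⇒m+n<o : k ≤ n → i < n ∸ k → i + k < n
m<o∸n⇒m+n<o {i = i} k≤n i<n∸k = m≤o∸n⇒m+n≤o (suc i) k≤n i<n∸k

period-shift : IsPeriod W k → i < length W ∸ k → at (drop k W) i ≡ at W i
period-shift {W} {k} {i} (_ , k≤W , per) i<W∸k = begin
  at (drop k W) i  ≡⟨ at-drop W k i ⟩
  at W (k + i)     ≡⟨ cong (at W) (+-comm k i) ⟩
  at W (i + k)     ≡⟨ per i (m<o∸n⇒m+n<o k≤W i<W∸k) ⟩
  at W i           ∎
  where open ≡-Reasoning

dropPrefix⇒isPeriod : 1 ≤ k → k ≤ length W → IsPrefix (drop k W) W → IsPeriod W k
dropPrefix⇒isPeriod {k} {W} 1≤k k≤W pre = 1≤k , k≤W , per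
  where
  per : ∀ i → i + k < length W → at W (i + k) ≡ at W i
  per i i+k<W = begin
    at W (i + k)     ≡⟨ cong (at W) (+-comm i k) ⟩
    at W (k + i)     ≡⟨ at-drop W k i ⟨
    at (drop k W) i  ≡⟨ at-prefix pre i<S ⟩
    at W i           ∎
    where
    open ≡-Reasoning
    i<S : i < length (drop k W)
    i<S = subst (i <_) (sym (length-drop k W)) (m+n≤o⇒m≤o∸n (suc i) i+k<W)

-- IsPerO = ShortestPeriodIn Odd and IsPerE = ShortestPeriodIn Even, definitionally.
ShortestPeriodIn : (ℕ → Set) → Word → ℕ → Set
ShortestPeriodIn P W p =
  (IsPeriod W p × P p × (∀ q → IsPeriod W q → P q → p ≤ q))
  ⊎ ((∀ q → IsPeriod W q → ¬ P q) × p ≡ suc (length W))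

shortestPeriod-bounds : ShortestPeriodIn P W p → 1 ≤ p × p ≤ suc (length W)
shortestPeriod-bounds (inj₁ ((1≤p , p≤W , _) , _)) = 1≤p , m≤n⇒m≤1+n p≤W
shortestPeriod-bounds (inj₂ (_ , refl))             = s≤s z≤n , ≤-refl

shortestPeriod-minimal : ShortestPeriodIn P W p → IsPeriod W k → P k → IsPeriod W p × P p × p ≤ k
shortestPeriod-minimal {k = k} (inj₁ (per , Pp , min)) perk Pk = per , Pp , min k perk Pk
shortestPeriod-minimal {k = k} (inj₂ (none , _))        perk Pk = contradiction Pk (none k perk)

preGalois⇒altLess : PreGalois W → 1 ≤ k → k ≤ length W →
  Fork j W (drop k W) a b → a ≢ b → AltLess j a b
preGalois⇒altLess {k = k} pg 1≤k k≤W f a≢b with pg k 1≤k k≤W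
... | inj₁ pre = contradiction (sym (isPrefix⇒≡ (fork-sym f) pre)) a≢b
... | inj₂ W≺ = ≺alt⇒altLess f a≢b W≺

preGalois⇒prefix⪯shift : PreGalois W → 1 ≤ p → p ≤ length W →
  factor W 1 (length W ∸ p) ⪯alt factor W (suc p) (length W)
preGalois⇒prefix⪯shift {W} {p} pg 1≤p p≤W with prefix⊎fork (drop p W) W (length-drop-≤ p W)
... | inj₁ pre = inj₂ (subst₂ _=alt_ (sym take-W) (sym take-S) (=alt-refl (drop p W)))
  where
  take-W : take (length W ∸ p) W ≡ drop p W
  take-W = subst (λ n → take n W ≡ drop p W) (length-drop p W) (isPrefix⇒take pre)
  take-S : take (length W ∸ p) (drop p W) ≡ drop p W
  take-S = take-all _ (drop p W) (≤-reflexive (length-drop p W))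
... | inj₂ (j , c , a , c≢a , f) =
  inj₁ (altLess⇒≺alt (fork-take j<n (fork-sym f))
                     (preGalois⇒altLess pg 1≤p p≤W (fork-sym f) (c≢a ∘ sym)))
  where
  j<n : j < length W ∸ p
  j<n = subst (j <_) (length-drop p W) (at-just⇒< (drop p W) j (atˡ f))

ShiftCondition : Word → ℕ → ℕ → Set
ShiftCondition T z p =
  factor (T ∷ʳ z) 1 (suc (length T) ∸ p) ⪯alt factor (T ∷ʳ z) (suc p) (suc (length T))

preGalois-∷ʳ⇒shiftCondition : ∀ T z → PreGalois (T ∷ʳ z) → 1 ≤ p → p ≤ suc (length T) →
  ShiftCondition T z p
preGalois-∷ʳ⇒shiftCondition {p} T z pg 1≤p p≤ =
  subst (λ n → factor (T ∷ʳ z) 1 (n ∸ p) ⪯alt factor (T ∷ʳ z) (suc p) n) (length-∷ʳ T z)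
    (preGalois⇒prefix⪯shift pg 1≤p (subst (p ≤_) (sym (length-∷ʳ T z)) p≤))

period⇒fork-∷ʳ : ∀ T z → IsPeriod T p → at T (length T ∸ p) ≡ just a →
  Fork (length T ∸ p) (T ∷ʳ z) (drop p T ∷ʳ z) a z
period⇒fork-∷ʳ {p} T z per@(1≤p , p≤T , _) eb = fork agree′ (trans (at-++ˡ T [ z ] m<T) eb) atʳ′
  where
  m<T : length T ∸ p < length T
  m<T = n∸k<n 1≤p p≤T
  agree′ : i < length T ∸ p → at (T ∷ʳ z) i ≡ at (drop p T ∷ʳ z) i
  agree′ {i} i<m = trans (at-++ˡ T [ z ] (<-trans i<m m<T)) (trans (sym (period-shift per i<m))
                 (sym (at-++ˡ (drop p T) [ z ] (subst (i <_) (sym (length-drop p T)) i<m))))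
  atʳ′ : at (drop p T ∷ʳ z) (length T ∸ p) ≡ just z
  atʳ′ = subst (λ n → at (drop p T ∷ʳ z) n ≡ just z) (length-drop p T) (at-∷ʳ (drop p T) z)

m∸n+[n∸o]≡m∸o : p ≤ k → k ≤ n → (n ∸ k) + (k ∸ p) ≡ n ∸ p
m∸n+[n∸o]≡m∸o {p} {k} {n} p≤k k≤n =
  trans (sym (+-∸-assoc (n ∸ k) p≤k)) (cong (_∸ p) (m∸n+n≡m k≤n))

preGalois-periods⇒altLess : PreGalois T → IsPeriod T k → IsPeriod T p → p ≤ k →
  at T (length T ∸ k) ≡ just a → at T (length T ∸ p) ≡ just b →
  a ≡ b ⊎ AltLess (length T ∸ k) a b
preGalois-periods⇒altLess {T} {k} {p} {a} {b} pg (_ , k≤T , perk) (_ , _ , perp) p≤k ea eb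
  with a ≟ b | m≤n⇒m<n∨m≡n p≤k
... | yes a≡b | _         = inj₁ a≡b
... | no a≢b  | inj₂ refl = contradiction (just-injective (trans (sym ea) eb)) a≢b
... | no a≢b  | inj₁ p<k  =
  inj₂ (preGalois⇒altLess pg (m<n⇒0<n∸m p<k) d≤T (fork agree′ ea atʳ′) a≢b)
  where
  d m : ℕ
  d = k ∸ p
  m = length T ∸ k
  d≤T : d ≤ length T
  d≤T = ≤-trans (m∸n≤m k p) k≤T
  agree′ : i < m → at T i ≡ at (drop d T) i
  agree′ {i} i<m = begin
    at T i            ≡⟨ perk i i+k<T ⟨
    at T (i + k)      ≡⟨ cong (at T) i+k≡d+i+p ⟩
    at T (d + i + p)  ≡⟨ perp (d + i) (subst (_< length T) i+k≡d+i+p i+k<T) ⟩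
    at T (d + i)      ≡⟨ at-drop T d i ⟨
    at (drop d T) i   ∎
    where
    open ≡-Reasoning
    i+k<T : i + k < length T
    i+k<T = m<o∸n⇒m+n<o k≤T i<m
    i+k≡d+i+p : i + k ≡ d + i + p
    i+k≡d+i+p = trans (cong (i +_) (sym (m∸n+n≡m (<⇒≤ p<k))))
                  (trans (sym (+-assoc i d p)) (cong (_+ p) (+-comm i d)))
  atʳ′ : at (drop d T) m ≡ just b
  atʳ′ = trans (at-drop T d m)
           (trans (cong (at T) (trans (+-comm d m) (m∸n+[n∸o]≡m∸o (<⇒≤ p<k) k≤T))) eb)

shiftCondition⇒altLess : ∀ T z → IsPeriod T p → at T (length T ∸ p) ≡ just b →
  ShiftCondition T z p → b ≡ z ⊎ AltLess (length T ∸ p) b z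
shiftCondition⇒altLess {p} {b} T z per@(_ , p≤T , _) eb cond with b ≟ z
... | yes b≡z = inj₁ b≡z
... | no b≢z = inj₂ (compare cond)
  where
  n′ : ℕ
  n′ = suc (length T) ∸ p
  f : Fork (length T ∸ p) (take n′ (T ∷ʳ z)) (take n′ (drop p (T ∷ʳ z))) b z
  f = fork-take (≤-reflexive (sym (+-∸-assoc 1 p≤T)))
        (subst (λ S → Fork _ (T ∷ʳ z) S b z) (sym (drop-∷ʳ T z p≤T))
           (period⇒fork-∷ʳ T z per eb))
  compare : ShiftCondition T z p → AltLess (length T ∸ p) b z
  compare (inj₁ T≺) = ≺alt⇒altLess f b≢z T≺
  compare (inj₂ T≈) = contradiction (=alt⇒≡ f T≈) b≢z

EveryPeriodCovered : Word → ℕ → Set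
EveryPeriodCovered T z = ∀ {k} → IsPeriod T k →
  ∃[ p ] (IsPeriod T p × p ≤ k × Even (k ∸ p) × ShiftCondition T z p)

periods⇒altLess : ∀ T z → PreGalois T → IsPeriod T k → IsPeriod T p → p ≤ k → Even (k ∸ p) →
  ShiftCondition T z p → at T (length T ∸ k) ≡ just a → a ≢ z → AltLess (length T ∸ k) a z
periods⇒altLess {k} {p} T z pg perk@(_ , k≤T , _) perp@(1≤p , p≤T , _) p≤k k∸p-even cond ea a≢z
  with <⇒at-just T (length T ∸ p) (n∸k<n 1≤p p≤T)
... | b , eb = altLess-trans-≡ (preGalois-periods⇒altLess pg perk perp p≤k ea eb)
                 (map₂ realign (shiftCondition⇒altLess T z perp eb cond)) a≢z
  where
  realign : AltLess (length T ∸ p) b z → AltLess (length T ∸ k) b z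
  realign r =
    altLess-+even k∸p-even (subst (λ j → AltLess j b z) (sym (m∸n+[n∸o]≡m∸o p≤k k≤T)) r)

period⇒suffix-∷ʳ : ∀ T z → PreGalois T → EveryPeriodCovered T z → IsPeriod T k →
  IsPrefix (drop k T ∷ʳ z) (T ∷ʳ z) ⊎ (T ∷ʳ z) ≺alt (drop k T ∷ʳ z)
period⇒suffix-∷ʳ {k} T z pg cover perk@(1≤k , k≤T , _)
  with <⇒at-just T (length T ∸ k) (n∸k<n 1≤k k≤T)
... | a , ea with a ≟ z
...   | yes refl =
  inj₁ (fork⇒isPrefix (fork-sym (period⇒fork-∷ʳ T z perk ea)) |S∷ʳz| S∷ʳz≤T∷ʳz)
  where
  |S∷ʳz| : length (drop k T ∷ʳ z) ≡ suc (length T ∸ k)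
  |S∷ʳz| = trans (length-∷ʳ (drop k T) z) (cong suc (length-drop k T))
  S∷ʳz≤T∷ʳz : length (drop k T ∷ʳ z) ≤ length (T ∷ʳ z)
  S∷ʳz≤T∷ʳz = subst₂ _≤_ (sym (length-∷ʳ (drop k T) z)) (sym (length-∷ʳ T z))
                (s≤s (length-drop-≤ k T))
...   | no a≢z with cover perk
...     | p , perp , p≤k , k∸p-even , cond =
  inj₂ (altLess⇒≺alt (period⇒fork-∷ʳ T z perk ea)
                     (periods⇒altLess T z pg perk perp p≤k k∸p-even cond ea a≢z))

suffix-∷ʳ : ∀ T z → PreGalois T → EveryPeriodCovered T z → 1 ≤ k → k ≤ length T →
  IsPrefix (drop k T ∷ʳ z) (T ∷ʳ z) ⊎ (T ∷ʳ z) ≺alt (drop k T ∷ʳ z)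
suffix-∷ʳ {k} T z pg cover 1≤k k≤T with prefix⊎fork (drop k T) T (length-drop-≤ k T)
... | inj₁ pre = period⇒suffix-∷ʳ T z pg cover (dropPrefix⇒isPeriod 1≤k k≤T pre)
... | inj₂ (_ , _ , _ , c≢a , f) = inj₂ (altLess⇒≺alt (fork-++ [ z ] [ z ] (fork-sym f))
                                      (preGalois⇒altLess pg 1≤k k≤T (fork-sym f) (c≢a ∘ sym)))

preGalois-∷ʳ : ∀ T z → PreGalois T → EveryPeriodCovered T z → PreGalois (T ∷ʳ z)
preGalois-∷ʳ T z pg cover k 1≤k k≤ with m≤n⇒m<n∨m≡n (subst (k ≤_) (length-∷ʳ T z) k≤)
... | inj₁ (s≤s k≤T) = subst (λ S → IsPrefix S (T ∷ʳ z) ⊎ (T ∷ʳ z) ≺alt S)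
                         (sym (drop-∷ʳ T z k≤T)) (suffix-∷ʳ T z pg cover 1≤k k≤T)
... | inj₂ refl = inj₁ (subst (λ S → IsPrefix S (T ∷ʳ z))
                          (sym (drop-all k (T ∷ʳ z) (≤-reflexive (length-∷ʳ T z)))) (T ∷ʳ z , refl))

shortestPeriods⇒covered : ∀ {T z po pe} → ShortestPeriodIn Odd T po → ShortestPeriodIn Even T pe →
  ShiftCondition T z po → ShiftCondition T z pe → EveryPeriodCovered T z
shortestPeriods⇒covered isPerO isPerE co ce {k} perk with even-or-odd k
... | inj₁ k-even = let per , pe-even , pe≤k = shortestPeriod-minimal isPerE perk k-even
                   in _ , per , pe≤k , even-∸ k-even pe-even , ce
... | inj₂ k-odd  = let per , po-odd , po≤k = shortestPeriod-minimal isPerO perk k-odd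
                   in _ , per , po≤k , odd-∸ k-odd po-odd , co

theorem18 : (T : Word) (z : ℕ) (po pe : ℕ) →
    PreGalois T → IsPerO T po → IsPerE T pe →
    (PreGalois (T ++ z ∷ [])
      ⇔ ((factor (T ++ z ∷ []) 1 (suc (length T) ∸ po) ⪯alt factor (T ++ z ∷ []) (suc po) (suc (length T)))
        × (factor (T ++ z ∷ []) 1 (suc (length T) ∸ pe) ⪯alt factor (T ++ z ∷ []) (suc pe) (suc (length T)))))
theorem18 T z po pe pg isPerO isPerE = mk⇔
  (λ pg′ → shiftCondition pg′ isPerO , shiftCondition pg′ isPerE)
  (λ (co , ce) → preGalois-∷ʳ T z pg (shortestPeriods⇒covered isPerO isPerE co ce))
  where
  shiftCondition : PreGalois (T ∷ʳ z) → ShortestPeriodIn P T p → ShiftCondition T z p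
  shiftCondition pg′ isPer with shortestPeriod-bounds isPer
  ... | 1≤p , p≤ = preGalois-∷ʳ⇒shiftCondition T z pg′ 1≤p p≤
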